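{- Let $n\ge 3$. The map $v\mapsto(\delta_{ijk}(v))_{1\le i<j<k\le n}$ is a bijection from the set of admitted vectors onto the set of families $(a_{ijk})_{1\le i<j<k\le n}$ with values in $\{0,1\}$ satisfying $a_{ijk}+a_{ikl}=a_{ijl}+a_{jkl}$ for all $1\le i<j<k<l\le n$.
   Context: $T=\{(i,j):1\le i<j\le n\}$. A vector $v\in\mathbb{N}^T$ is admitted if $v_{i,i+1}=0$ for all $1\le i<n$ and $v_{ij}+v_{jk}\le v_{ik}\le v_{ij}+v_{jk}+1$ for all $1\le i<j<k\le n$. For $i<j<k$, $\delta_{ijk}(v)=v_{ik}-v_{ij}-v_{jk}$. -}

module Defs where

open import Data.Nat using (ℕ; suc; _≤_; _<_)
open import Data.Integer as ℤ using (ℤ; +_; _-_)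
open import Data.Product using (_×_)
open import Data.Sum using (_⊎_)
open import Relation.Binary.PropositionalEquality using (_≡_)

-- A vector v ∈ ℕ^T is represented by a function ℕ → ℕ → ℕ, of which only the
-- values v i j with 1 ≤ i < j ≤ n matter (vectors are compared pointwise on T).
Vec2 : Set
Vec2 = ℕ → ℕ → ℕ

Fam3 : Set
Fam3 = ℕ → ℕ → ℕ → ℤ

Admitted : ℕ → Vec2 → Set
Admitted n v =
  (∀ i → 1 ≤ i → i < n → v i (suc i) ≡ 0)
  × (∀ i j k → 1 ≤ i → i < j → j < k → k ≤ n →
       (v i j Data.Nat.+ v j k ≤ v i k) × (v i k ≤ v i j Data.Nat.+ v j k Data.Nat.+ 1))

δ : Vec2 → Fam3
δ v i j k = + v i k - + v i j - + v j k

EqT2 : ℕ → Vec2 → Vec2 → Set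
EqT2 n v w = ∀ i j → 1 ≤ i → i < j → j ≤ n → v i j ≡ w i j

EqT3 : ℕ → Fam3 → Fam3 → Set
EqT3 n a b = ∀ i j k → 1 ≤ i → i < j → j < k → k ≤ n → a i j k ≡ b i j k

Good : ℕ → Fam3 → Set
Good n a =
  (∀ i j k → 1 ≤ i → i < j → j < k → k ≤ n → (a i j k ≡ + 0) ⊎ (a i j k ≡ + 1))
  × (∀ i j k l → 1 ≤ i → i < j → j < k → k < l → l ≤ n →
       a i j k ℤ.+ a i k l ≡ a i j l ℤ.+ a j k l)

{-# OPTIONS --safe #-}
module Submission where

-- An admitted vector is determined by its excesses δ, since along the
-- superdiagonal it vanishes and v_{i,j+1} = v_{ij} + δ_{i,j,j+1}(v).  The
-- admissibility inequalities say exactly that each δ_{ijk} is 0 or 1, and the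
-- identity δ_{ijk} + δ_{ikl} = δ_{ijl} + δ_{jkl} holds for every v.  Conversely a
-- {0,1}-family a is realised by v_{ij} = Σ_{i<m<j} a_{i,m,m+1}: the cocycle
-- identity propagates δ(v) = a from the superdiagonal triples to all triples.

open import Defs
open import Data.Nat using (ℕ; _≤_)
open import Data.Product using (Σ; _×_)

open import Data.Nat as ℕ using (zero; suc; _<_; z≤n; _<?_)
import Data.Nat.Properties as ℕP
open import Data.Integer using (ℤ; +_; _+_; _-_; ∣_∣; 0ℤ)
import Data.Integer as ℤ
import Data.Integer.Properties as ℤP
open import Data.Integer.Tactic.RingSolver using (solve-∀)
open import Data.Product using (_,_; proj₁)
open import Data.Sum using (_⊎_; inj₁; inj₂)
open import Data.Empty using (⊥-elim)
open import Relation.Nullary using (yes; no)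
open import Relation.Binary.PropositionalEquality

open ≡-Reasoning

IsBit : ℤ → Set
IsBit a = (a ≡ + 0) ⊎ (a ≡ + 1)

IsBit⇒0≤ : ∀ {a} → IsBit a → 0ℤ ℤ.≤ a
IsBit⇒0≤ (inj₁ refl) = ℤP.≤-refl
IsBit⇒0≤ (inj₂ refl) = ℤ.+≤+ z≤n

excess : ℕ → ℕ → ℕ → ℤ
excess x y z = + z - + x - + y

pos-+-+ : ∀ x y d → + (x ℕ.+ y ℕ.+ d) ≡ + x + + y + + d
pos-+-+ x y d = trans (ℤP.pos-+ (x ℕ.+ y) d) (cong (_+ + d) (ℤP.pos-+ x y))

excess≡⇒ : ∀ x y z d → excess x y z ≡ + d → z ≡ x ℕ.+ y ℕ.+ d
excess≡⇒ x y z d e = ℤP.+-injective (begin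
  + z                       ≡⟨ split (+ z) (+ x) (+ y) ⟩
  + x + + y + excess x y z  ≡⟨ cong (_+_ (+ x + + y)) e ⟩
  + x + + y + + d           ≡⟨ pos-+-+ x y d ⟨
  + (x ℕ.+ y ℕ.+ d)         ∎)
  where
  split : ∀ (z x y : ℤ) → z ≡ x + y + (z - x - y)
  split = solve-∀

excess-+ : ∀ x y d → excess x y (x ℕ.+ y ℕ.+ d) ≡ + d
excess-+ x y d = begin
  excess x y (x ℕ.+ y ℕ.+ d)       ≡⟨ cong (λ t → t - + x - + y) (pos-+-+ x y d) ⟩
  (+ x + + y + + d) - + x - + y    ≡⟨ cancel (+ x) (+ y) (+ d) ⟩
  + d                              ∎
  where
  cancel : ∀ (x y d : ℤ) → (x + y + d) - x - y ≡ d
  cancel = solve-∀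

IsBit-excess⇒bounds : ∀ x y z → IsBit (excess x y z) →
                      x ℕ.+ y ≤ z × z ≤ x ℕ.+ y ℕ.+ 1
IsBit-excess⇒bounds x y z (inj₁ e) rewrite excess≡⇒ x y z 0 e =
  ℕP.m≤m+n (x ℕ.+ y) 0 , ℕP.+-monoʳ-≤ (x ℕ.+ y) z≤n
IsBit-excess⇒bounds x y z (inj₂ e) rewrite excess≡⇒ x y z 1 e =
  ℕP.m≤m+n (x ℕ.+ y) 1 , ℕP.≤-refl

bounds⇒IsBit-excess : ∀ x y z → x ℕ.+ y ≤ z → z ≤ x ℕ.+ y ℕ.+ 1 →
                      IsBit (excess x y z)
bounds⇒IsBit-excess x y z lo hi with ℕP.m≤n⇒∃[o]m+o≡n lo
... | d , refl with ℕP.n≤1⇒n≡0∨n≡1 (ℕP.+-cancelˡ-≤ (x ℕ.+ y) d 1 hi)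
... | inj₁ refl = inj₁ (excess-+ x y 0)
... | inj₂ refl = inj₂ (excess-+ x y 1)

δ-cocycle : ∀ v i j k l → δ v i j k + δ v i k l ≡ δ v i j l + δ v j k l
δ-cocycle v i j k l = identity (+ v i j) (+ v i k) (+ v i l) (+ v j k) (+ v j l) (+ v k l)
  where
  identity : ∀ (ij ik il jk jl kl : ℤ) →
             (ik - ij - jk) + (il - ik - kl) ≡ (il - ij - jl) + (jl - jk - kl)
  identity = solve-∀

δ-good : ∀ n v → Admitted n v → Good n (δ v)
δ-good n v (_ , bounds) =
  (λ i j k 1≤i i<j j<k k≤n →
     let (lo , hi) = bounds i j k 1≤i i<j j<k k≤n
     in bounds⇒IsBit-excess (v i j) (v j k) (v i k) lo hi)
  , λ i j k l _ _ _ _ _ → δ-cocycle v i j k l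

SuperdiagonalZero : ℕ → Vec2 → Set
SuperdiagonalZero n v = ∀ i → 1 ≤ i → i < n → v i (suc i) ≡ 0

δ-step : ∀ {n} v → SuperdiagonalZero n v → ∀ {i j} → 1 ≤ i → i < j → j < n →
         + v i (suc j) ≡ + v i j + δ v i j (suc j)
δ-step v zero-on-superdiagonal {i} {j} 1≤i i<j j<n = begin
  + v i (suc j)                               ≡⟨ split (+ v i (suc j)) (+ v i j) (+ v j (suc j)) ⟩
  + v i j + + v j (suc j) + δ v i j (suc j)   ≡⟨ cong (λ t → + v i j + + t + δ v i j (suc j)) v[j,j+1]≡0 ⟩
  + v i j + + 0 + δ v i j (suc j)             ≡⟨ cong (_+ δ v i j (suc j)) (ℤP.+-identityʳ (+ v i j)) ⟩
  + v i j + δ v i j (suc j)                   ∎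
  where
  split : ∀ (z x y : ℤ) → z ≡ x + y + (z - x - y)
  split = solve-∀
  v[j,j+1]≡0 : v j (suc j) ≡ 0
  v[j,j+1]≡0 = zero-on-superdiagonal j (ℕP.≤-trans 1≤i (ℕP.<⇒≤ i<j)) j<n

δ-injective : ∀ {n} v w → SuperdiagonalZero n v → SuperdiagonalZero n w →
              EqT3 n (δ v) (δ w) → EqT2 n v w
δ-injective v w v0 w0 δv≡δw i (suc j) 1≤i i<j+1 j+1≤n
  with ℕP.m≤n⇒m<n∨m≡n (ℕ.s≤s⁻¹ i<j+1)
... | inj₂ refl = trans (v0 i 1≤i j+1≤n) (sym (w0 i 1≤i j+1≤n))
... | inj₁ i<j = ℤP.+-injective (begin
  + v i (suc j)               ≡⟨ δ-step v v0 1≤i i<j j+1≤n ⟩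
  + v i j + δ v i j (suc j)   ≡⟨ cong₂ _+_ (cong +_ v[i,j]≡w[i,j]) (δv≡δw i j (suc j) 1≤i i<j ℕP.≤-refl j+1≤n) ⟩
  + w i j + δ w i j (suc j)   ≡⟨ δ-step w w0 1≤i i<j j+1≤n ⟨
  + w i (suc j)               ∎)
  where
  v[i,j]≡w[i,j] : v i j ≡ w i j
  v[i,j]≡w[i,j] = δ-injective v w v0 w0 δv≡δw i j 1≤i i<j (ℕP.<⇒≤ j+1≤n)

accumulate : Fam3 → Vec2
accumulate a i zero = 0
accumulate a i (suc j) with i <? j
... | yes _ = accumulate a i j ℕ.+ ∣ a i j (suc j) ∣
... | no _  = 0

accumulate-superdiagonal : ∀ a i → accumulate a i (suc i) ≡ 0
accumulate-superdiagonal a i with i <? i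
... | yes i<i = ⊥-elim (ℕP.<-irrefl refl i<i)
... | no _    = refl

accumulate-step : ∀ a {i j} → i < j → 0ℤ ℤ.≤ a i j (suc j) →
                  + accumulate a i (suc j) ≡ + accumulate a i j + a i j (suc j)
accumulate-step a {i} {j} i<j 0≤a with i <? j
... | no i≮j = ⊥-elim (i≮j i<j)
... | yes _  = trans (ℤP.pos-+ (accumulate a i j) _)
                     (cong (_+_ (+ accumulate a i j)) (ℤP.0≤i⇒+∣i∣≡i 0≤a))

δ-accumulate : ∀ {n a} → Good n a → EqT3 n (δ (accumulate a)) a
δ-accumulate {a = a} (bit , cocycle) i j (suc k) 1≤i i<j j<k+1 k+1≤n
  with ℕP.m≤n⇒m<n∨m≡n (ℕ.s≤s⁻¹ j<k+1)
... | inj₂ refl = begin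
  + w i (suc j) - + w i j - + w j (suc j)   ≡⟨ cong (λ t → + w i (suc j) - + w i j - + t) (accumulate-superdiagonal a j) ⟩
  + w i (suc j) - + w i j - + 0             ≡⟨ cong (λ t → t - + w i j - + 0) step ⟩
  (+ w i j + a i j (suc j)) - + w i j - + 0 ≡⟨ cancel (+ w i j) (a i j (suc j)) ⟩
  a i j (suc j)                             ∎
  where
  w : Vec2
  w = accumulate a
  step : + w i (suc j) ≡ + w i j + a i j (suc j)
  step = accumulate-step a i<j (IsBit⇒0≤ (bit i j (suc j) 1≤i i<j ℕP.≤-refl k+1≤n))
  cancel : ∀ (x d : ℤ) → (x + d) - x - + 0 ≡ d
  cancel = solve-∀
... | inj₁ j<k = begin
  + w i (suc k) - + w i j - + w j (suc k)
    ≡⟨ cong₂ (λ s t → s - + w i j - t) (step 1≤i (ℕP.<-trans i<j j<k)) (step 1≤j j<k) ⟩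
  (+ w i k + a i k (suc k)) - + w i j - (+ w j k + a j k (suc k))
    ≡⟨ regroup (+ w i k) (+ w i j) (+ w j k) (a i k (suc k)) (a j k (suc k)) ⟩
  δ w i j k + a i k (suc k) - a j k (suc k)
    ≡⟨ cong (λ t → t + a i k (suc k) - a j k (suc k)) (δ-accumulate (bit , cocycle) i j k 1≤i i<j j<k (ℕP.<⇒≤ k+1≤n)) ⟩
  a i j k + a i k (suc k) - a j k (suc k)
    ≡⟨ cong (_- a j k (suc k)) (cocycle i j k (suc k) 1≤i i<j j<k ℕP.≤-refl k+1≤n) ⟩
  a i j (suc k) + a j k (suc k) - a j k (suc k)
    ≡⟨ cancel (a i j (suc k)) (a j k (suc k)) ⟩
  a i j (suc k) ∎
  where
  w : Vec2
  w = accumulate a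
  1≤j : 1 ≤ j
  1≤j = ℕP.≤-trans 1≤i (ℕP.<⇒≤ i<j)
  step : ∀ {m} → 1 ≤ m → m < k → + w m (suc k) ≡ + w m k + a m k (suc k)
  step {m} 1≤m m<k = accumulate-step a m<k (IsBit⇒0≤ (bit m k (suc k) 1≤m m<k ℕP.≤-refl k+1≤n))
  regroup : ∀ (ik ij jk p q : ℤ) → (ik + p) - ij - (jk + q) ≡ (ik - ij - jk) + p - q
  regroup = solve-∀
  cancel : ∀ (x q : ℤ) → x + q - q ≡ x
  cancel = solve-∀

accumulate-admitted : ∀ {n a} → Good n a → Admitted n (accumulate a)
accumulate-admitted {a = a} good =
  (λ i _ _ → accumulate-superdiagonal a i)
  , λ i j k 1≤i i<j j<k k≤n →
      IsBit-excess⇒bounds (w i j) (w j k) (w i k)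
        (subst IsBit (sym (δ-accumulate good i j k 1≤i i<j j<k k≤n))
               (proj₁ good i j k 1≤i i<j j<k k≤n))
  where
  w : Vec2
  w = accumulate a

theorem5p1 : (n : ℕ) → 3 ≤ n →
    ((v : Vec2) → Admitted n v → Good n (δ v))
    × ((v w : Vec2) → Admitted n v → Admitted n w → EqT3 n (δ v) (δ w) → EqT2 n v w)
    × ((a : Fam3) → Good n a → Σ Vec2 (λ v → Admitted n v × EqT3 n (δ v) a))
theorem5p1 n _ =
  δ-good n
  , (λ v w (v0 , _) (w0 , _) → δ-injective v w v0 w0)
  , λ a good → accumulate a , accumulate-admitted good , δ-accumulate good
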